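{- For each $n\ge 2$ and each $k\ge 1$ there exists a $1$-PDDS$[P_k]$ in $\Lambda_n$.
   Context: $\Lambda_n$ is the infinite graph with vertex set $\mathbb{Z}^n$ in which two vertices are adjacent iff their Euclidean distance is $1$; $d$ denotes graph distance. For $S$ a set of vertices, $[S]$ is the induced subgraph and $d(v,C)=\min\{d(v,w):w\in C\}$. For $t\ge1$, $S$ is a $t$-perfect distance-dominating set ($t$-PDDS) if for each vertex $v$ there is a unique component $C_v$ of $[S]$ with $d(v,C_v)\le t$, and there is in $C_v$ a unique vertex $w$ with $d(v,w)=d(v,C_v)$. A $t$-PDDS$[H]$ is a $t$-PDDS all of whose components are isomorphic to the fixed finite graph $H$. $P_k$ is the path on $k$ vertices. -}

module Defs where

open import Data.Nat using (ℕ; zero; suc; _≤_; _+_)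
open import Data.Integer as ℤ using (ℤ; +_)
open import Data.Vec using (Vec; []; _∷_)
open import Data.Fin using (Fin; toℕ)
open import Data.Unit using (⊤)
open import Data.Product using (Σ; ∃; _×_)
open import Data.Sum using (_⊎_)
open import Function.Bundles using (_⇔_)
open import Relation.Binary.PropositionalEquality using (_≡_)

-- Vertices of Λ_n : points of ℤ^n
Vertex : ℕ → Set
Vertex n = Vec ℤ n

sqDist : ∀ {n} → Vertex n → Vertex n → ℤ
sqDist [] [] = + 0
sqDist (x ∷ u) (y ∷ v) = (x ℤ.- y) ℤ.* (x ℤ.- y) ℤ.+ sqDist u v

Adj : ∀ {n} → Vertex n → Vertex n → Set
Adj u v = sqDist u v ≡ + 1

data WalkIn {n} (P : Vertex n → Set) : Vertex n → Vertex n → ℕ → Set where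
  here : ∀ {x} → P x → WalkIn P x x 0
  step : ∀ {x y z m} → P x → Adj x y → WalkIn P y z m → WalkIn P x z (suc m)

Walk : ∀ {n} → Vertex n → Vertex n → ℕ → Set
Walk = WalkIn (λ _ → ⊤)

Dist : ∀ {n} → Vertex n → Vertex n → ℕ → Set
Dist v w m = Walk v w m × (∀ m' → Walk v w m' → m ≤ m')

DistSet : ∀ {n} → Vertex n → (Vertex n → Set) → ℕ → Set
DistSet v C m = (Σ _ λ w → C w × Dist v w m)
              × (∀ w m' → C w → Dist v w m' → m ≤ m')

ConnIn : ∀ {n} → (Vertex n → Set) → Vertex n → Vertex n → Set
ConnIn S x y = ∃ λ m → WalkIn S x y m

IsComponent : ∀ {n} → (Vertex n → Set) → (Vertex n → Set) → Set
IsComponent S C = (∃ λ c → C c)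
                × (∀ x → C x → S x)
                × (∀ x y → C x → (C y ⇔ ConnIn S x y))

SameSet : ∀ {n} → (Vertex n → Set) → (Vertex n → Set) → Set
SameSet C D = ∀ x → C x ⇔ D x

IsPDDS : ∀ {n} → ℕ → (Vertex n → Set) → Set₁
IsPDDS {n} t S = ∀ (v : Vertex n) → Σ (Vertex n → Set) λ C →
    IsComponent S C
  × (Σ ℕ λ m → m ≤ t × DistSet v C m
      × (∀ C' m' → IsComponent S C' → m' ≤ t → DistSet v C' m' → SameSet C' C)
      × (Σ (Vertex n) λ w → C w × Dist v w m
          × (∀ w' → C w' → Dist v w' m → w' ≡ w)))

PathAdj : ∀ {k} → Fin k → Fin k → Set
PathAdj i j = (toℕ i + 1 ≡ toℕ j) ⊎ (toℕ j + 1 ≡ toℕ i)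

IsoPath : ∀ {n} → (Vertex n → Set) → ℕ → Set
IsoPath {n} C k = Σ (Fin k → Vertex n) λ f →
    (∀ i → C (f i))
  × (∀ x → C x → ∃ λ i → f i ≡ x)
  × (∀ i j → f i ≡ f j → i ≡ j)
  × (∀ i j → Adj (f i) (f j) ⇔ PathAdj i j)

IsPDDS-Pk : ∀ {n} → ℕ → ℕ → (Vertex n → Set) → Set₁
IsPDDS-Pk t k S = IsPDDS t S × (∀ C → IsComponent S C → IsoPath C k)

-- Write n = 1 + n', k = 1 + k', N = 2 + (2n' + 1)k, give the coordinates the weights 1 and
-- 1 + (j + 1)k (j < n'), and let S be the set of vertices whose weighted coordinate sum is
-- congruent to one of 0, …, k - 1 modulo N. Moving along the first axis changes this residue
-- by ±1, so the components of S are runs of k consecutive points on lines parallel to that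
-- axis, i.e. copies of P_k. A unit step ±e_j changes the residue by ±(weight of j), and for the
-- 2n steps the residues from which the step lands in S are the intervals [1 + mk, 1 + (m + 1)k),
-- m = 0, …, 2n - 1, taken modulo N. They cover the residues k, …, N - 1 of the vertices outside S
-- exactly once, so every such vertex has exactly one neighbour in S, which is the 1-PDDS property.
module Submission where

open import Defs
open import Data.Nat using (ℕ; _≤_)
open import Data.Product using (Σ)

open import Data.Nat as ℕ using (zero; suc; z≤n; s≤s; _<_; _<?_; NonZero)
import Data.Nat.Properties as ℕ
import Data.Nat.Tactic.RingSolver as ℕ-Ring
open import Data.Integer as ℤ using (ℤ; +_; -[1+_]; _%ℕ_; _/ℕ_)
import Data.Integer.Properties as ℤ
open import Data.Integer.DivMod using (a≡a%ℕn+[a/ℕn]*n; n%ℕd<d)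
open import Data.Integer.Tactic.RingSolver using (solve-∀)
open import Data.Nat.DivMod
  using (_%_; _/_; m≡m%n+[m/n]*n; m%n<n; m<n⇒m%n≡m; [m+n]%n≡m%n; +-distrib-/-∣ʳ; m<n⇒m/n≡0; m*n/n≡m; m<n*o⇒m/o<n)
open import Data.Nat.Divisibility using (divides-refl)
open import Data.Vec using ([]; _∷_)
open import Data.Vec.Properties using (∷-injectiveˡ; ∷-injectiveʳ)
open import Data.Fin using (Fin; zero; suc; toℕ; fromℕ<; opposite)
open import Data.Fin.Properties using (toℕ-injective; toℕ<n; toℕ-fromℕ<; opposite-prop; opposite-involutive)
open import Data.Bool using (Bool; true; false; not)
open import Data.Unit using (tt)
open import Data.Product using (∃; _×_; _,_; proj₁; proj₂)
open import Data.Sum using (_⊎_; inj₁; inj₂)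
open import Data.Empty using (⊥-elim)
open import Function.Bundles using (_⇔_; mk⇔; Equivalence)
open import Relation.Nullary using (¬_; Dec; yes; no)
open import Relation.Binary.PropositionalEquality
open import Algebra.Properties.AbelianGroup ℤ.+-0-abelianGroup using () renaming (∙-cancelˡ to ℤ-+-cancelˡ)

-- Geometry of Λ_n

sgn : Bool → ℤ
sgn true = + 1
sgn false = -[1+ 0 ]

move : ∀ {n} → Vertex n → Fin n → Bool → Vertex n
move (x ∷ v) zero b = (x ℤ.+ sgn b) ∷ v
move (x ∷ v) (suc j) b = x ∷ move v j b

sqDist-self : ∀ {n} (v : Vertex n) → sqDist v v ≡ + 0
sqDist-self [] = refl
sqDist-self (x ∷ v) rewrite ℤ.+-inverseʳ x | sqDist-self v = refl

sqDist-sym : ∀ {n} (u v : Vertex n) → sqDist u v ≡ sqDist v u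
sqDist-sym [] [] = refl
sqDist-sym (x ∷ u) (y ∷ v) = cong₂ ℤ._+_ (square-sym x y) (sqDist-sym u v)
  where
  square-sym : ∀ x y → (x ℤ.- y) ℤ.* (x ℤ.- y) ≡ (y ℤ.- x) ℤ.* (y ℤ.- x)
  square-sym = solve-∀

sqDist-natural : ∀ {n} (u v : Vertex n) → ∃ λ s → sqDist u v ≡ + s
sqDist-natural [] [] = 0 , refl
sqDist-natural (x ∷ u) (y ∷ v) with sqDist-natural u v
... | s , e = square (x ℤ.- y) ℕ.+ s ,
  trans (cong₂ ℤ._+_ (square-natural (x ℤ.- y)) e) (sym (ℤ.pos-+ (square (x ℤ.- y)) s))
  where
  square : ℤ → ℕ
  square d = ℤ.∣ d ∣ ℕ.* ℤ.∣ d ∣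
  square-natural : ∀ d → d ℤ.* d ≡ + square d
  square-natural (+ m) = sym (ℤ.pos-* m m)
  square-natural -[1+ m ] = refl

sqDist≡0⇒≡ : ∀ {n} {u v : Vertex n} → sqDist u v ≡ + 0 → u ≡ v
sqDist≡0⇒≡ {u = []} {[]} _ = refl
sqDist≡0⇒≡ {u = x ∷ u} {y ∷ v} e with sqDist-natural u v | x ℤ.- y in x-y
... | _ , _ | + 0 = cong₂ _∷_ (ℤ.i-j≡0⇒i≡j x y x-y) (sqDist≡0⇒≡ (trans (sym (ℤ.+-identityˡ _)) e))
... | _ , e' | d@(+ suc _) with () ← trans (cong (ℤ._+_ (d ℤ.* d)) (sym e')) e
... | _ , e' | d@(-[1+ _ ]) with () ← trans (cong (ℤ._+_ (d ℤ.* d)) (sym e')) e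

Adj-sym : ∀ {n} {u v : Vertex n} → Adj u v → Adj v u
Adj-sym {u = u} {v} a = trans (sqDist-sym v u) a

Adj-irrefl : ∀ {n} {v : Vertex n} → ¬ Adj v v
Adj-irrefl {v = v} a with () ← trans (sym (sqDist-self v)) a

Adj-move : ∀ {n} (v : Vertex n) j b → Adj v (move v j b)
Adj-move (x ∷ v) zero b =
  trans (cong₂ ℤ._+_ (cong (λ t → t ℤ.* t) (x-[x+d]≡-d x (sgn b))) (sqDist-self v)) (unit-square b)
  where
  x-[x+d]≡-d : ∀ x d → x ℤ.- (x ℤ.+ d) ≡ ℤ.- d
  x-[x+d]≡-d = solve-∀
  unit-square : ∀ b → ℤ.- sgn b ℤ.* ℤ.- sgn b ℤ.+ + 0 ≡ + 1
  unit-square true = refl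
  unit-square false = refl
Adj-move (x ∷ v) (suc j) b rewrite ℤ.+-inverseʳ x = trans (ℤ.+-identityˡ _) (Adj-move v j b)

private
  y≡x-[x-y] : ∀ {x y d} → x ℤ.- y ≡ d → y ≡ x ℤ.- d
  y≡x-[x-y] {x} {y} refl = lemma x y
    where
    lemma : ∀ x y → y ≡ x ℤ.- (x ℤ.- y)
    lemma = solve-∀

Adj⇒move : ∀ {n} {u v : Vertex n} → Adj u v → ∃ λ j → ∃ λ b → v ≡ move u j b
Adj⇒move {u = []} {[]} ()
Adj⇒move {u = x ∷ u} {y ∷ v} a with sqDist-natural u v | x ℤ.- y in x-y
... | _ , _ | + 0 with Adj⇒move (trans (sym (ℤ.+-identityˡ _)) a)
...   | j , b , e = suc j , b , cong₂ _∷_ (sym (ℤ.i-j≡0⇒i≡j x y x-y)) e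
Adj⇒move {u = x ∷ u} {y ∷ v} a | _ , e' | + 1 with trans (cong (ℤ._+_ (+ 1)) (sym e')) a
... | refl = zero , false , cong₂ _∷_ (y≡x-[x-y] {x} x-y) (sym (sqDist≡0⇒≡ e'))
Adj⇒move {u = x ∷ u} {y ∷ v} a | _ , e' | -[1+ 0 ] with trans (cong (ℤ._+_ (+ 1)) (sym e')) a
... | refl = zero , true , cong₂ _∷_ (y≡x-[x-y] {x} x-y) (sym (sqDist≡0⇒≡ e'))
Adj⇒move {u = x ∷ u} {y ∷ v} a | _ , e' | d@(+ suc (suc _)) with () ← trans (cong (ℤ._+_ (d ℤ.* d)) (sym e')) a
Adj⇒move {u = x ∷ u} {y ∷ v} a | _ , e' | d@(-[1+ suc _ ]) with () ← trans (cong (ℤ._+_ (d ℤ.* d)) (sym e')) a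

-- Walks and components

module _ {n} {P : Vertex n → Set} where

  WalkIn-head : ∀ {x y m} → WalkIn P x y m → P x
  WalkIn-head (here p) = p
  WalkIn-head (step p _ _) = p

  WalkIn-last : ∀ {x y m} → WalkIn P x y m → P y
  WalkIn-last (here p) = p
  WalkIn-last (step _ _ w) = WalkIn-last w

  WalkIn-snoc : ∀ {x y z m} → WalkIn P x y m → Adj y z → P z → WalkIn P x z (suc m)
  WalkIn-snoc (here p) a q = step p a (here q)
  WalkIn-snoc (step p a w) b q = step p a (WalkIn-snoc w b q)

  WalkIn-reverse : ∀ {x y m} → WalkIn P x y m → WalkIn P y x m
  WalkIn-reverse (here p) = here p
  WalkIn-reverse (step {x} {y} p a w) = WalkIn-snoc (WalkIn-reverse w) (Adj-sym {u = x} {y} a) p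

  WalkIn-++ : ∀ {x y z m m'} → WalkIn P x y m → WalkIn P y z m' → WalkIn P x z (m ℕ.+ m')
  WalkIn-++ (here _) w = w
  WalkIn-++ (step p a v) w = step p a (WalkIn-++ v w)

  WalkIn-0⇒≡ : ∀ {x y} → WalkIn P x y 0 → x ≡ y
  WalkIn-0⇒≡ (here _) = refl

  WalkIn-1⇒Adj : ∀ {x y} → WalkIn P x y 1 → Adj x y
  WalkIn-1⇒Adj (step _ a (here _)) = a

Dist-refl : ∀ {n} (v : Vertex n) → Dist v v 0
Dist-refl v = here tt , λ _ _ → z≤n

Adj⇒Dist1 : ∀ {n} {v w : Vertex n} → Adj v w → Dist v w 1
Adj⇒Dist1 {v = v} {w} a = step tt a (here tt) , minimal
  where
  minimal : ∀ m → Walk v w m → 1 ≤ m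
  minimal zero p = ⊥-elim (Adj-irrefl {v = v} (subst (Adj v) (sym (WalkIn-0⇒≡ p)) a))
  minimal (suc _) _ = s≤s z≤n

module _ {n} {S : Vertex n → Set} where

  ConnIn-refl : ∀ {x} → S x → ConnIn S x x
  ConnIn-refl s = 0 , here s

  ConnIn-sym : ∀ {x y} → ConnIn S x y → ConnIn S y x
  ConnIn-sym (m , w) = m , WalkIn-reverse w

  ConnIn-trans : ∀ {x y z} → ConnIn S x y → ConnIn S y z → ConnIn S x z
  ConnIn-trans (m , v) (m' , w) = m ℕ.+ m' , WalkIn-++ v w

  ConnIn-last : ∀ {x y} → ConnIn S x y → S y
  ConnIn-last (_ , w) = WalkIn-last w

  ConnIn-adj : ∀ {x y} → S x → S y → Adj x y → ConnIn S x y
  ConnIn-adj s t a = 1 , step s a (here t)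

  ConnIn-isComponent : ∀ {x} → S x → IsComponent S (ConnIn S x)
  ConnIn-isComponent {x} s =
    (x , ConnIn-refl s) ,
    (λ _ → ConnIn-last) ,
    λ y z xy → mk⇔ (ConnIn-trans (ConnIn-sym xy)) (ConnIn-trans xy)

  component≈ConnIn : ∀ {C x} → IsComponent S C → C x → SameSet C (ConnIn S x)
  component≈ConnIn (_ , _ , conn) cx y = conn _ y cx

  component≈ConnIn-via : ∀ {C x w} → IsComponent S C → C w → ConnIn S x w → SameSet C (ConnIn S x)
  component≈ConnIn-via c cw xw y =
    mk⇔ (λ cy → ConnIn-trans xw (Equivalence.to (component≈ConnIn c cw y) cy))
        (λ xy → Equivalence.from (component≈ConnIn c cw y) (ConnIn-trans (ConnIn-sym xw) xy))

IsoPath-resp : ∀ {n} {C D : Vertex n → Set} {k} → SameSet C D → IsoPath D k → IsoPath C k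
IsoPath-resp C≈D (f , inD , cover , injective , adj) =
  f , (λ i → Equivalence.from (C≈D (f i)) (inD i)) ,
  (λ x cx → cover x (Equivalence.to (C≈D x) cx)) , injective , adj

UniqueNeighbourIn : ∀ {n} → (Vertex n → Set) → Vertex n → Set
UniqueNeighbourIn S v = ∃ λ w → S w × Adj v w × (∀ w' → S w' → Adj v w' → w' ≡ w)

DistSet≤1⇒near : ∀ {n} {v : Vertex n} {C m} → m ≤ 1 → DistSet v C m → ∃ λ w → C w × (v ≡ w ⊎ Adj v w)
DistSet≤1⇒near {m = 0} _ ((w , cw , d , _) , _) = w , cw , inj₁ (WalkIn-0⇒≡ d)
DistSet≤1⇒near {m = 1} _ ((w , cw , d , _) , _) = w , cw , inj₂ (WalkIn-1⇒Adj d)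
DistSet≤1⇒near {m = suc (suc _)} (s≤s ()) _

unique-neighbours⇒PDDS : ∀ {n} {S : Vertex n → Set} → (∀ v → Dec (S v)) →
  (∀ v → ¬ S v → UniqueNeighbourIn S v) → IsPDDS 1 S
unique-neighbours⇒PDDS {S = S} S? unique v with S? v
... | yes sv = ConnIn S v , ConnIn-isComponent sv , 0 , z≤n ,
  ((v , ConnIn-refl sv , Dist-refl v) , λ _ _ _ _ → z≤n) , only ,
  (v , ConnIn-refl sv , Dist-refl v , λ _ _ d → sym (WalkIn-0⇒≡ (proj₁ d)))
  where
  only : ∀ C' m' → IsComponent S C' → m' ≤ 1 → DistSet v C' m' → SameSet C' (ConnIn S v)
  only C' m' c m'≤1 d with DistSet≤1⇒near m'≤1 d
  ... | w , cw , inj₁ refl = component≈ConnIn c cw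
  ... | w , cw , inj₂ a = component≈ConnIn-via c cw (ConnIn-adj sv (proj₁ (proj₂ c) w cw) a)
... | no ¬sv with unique v ¬sv
... | w , sw , a , w-unique = ConnIn S w , ConnIn-isComponent sw , 1 , ℕ.≤-refl ,
  ((w , ConnIn-refl sw , Adj⇒Dist1 a) , minimal) , only ,
  (w , ConnIn-refl sw , Adj⇒Dist1 a , λ w' cw' d → w-unique w' (ConnIn-last cw') (WalkIn-1⇒Adj (proj₁ d)))
  where
  minimal : ∀ y m → ConnIn S w y → Dist v y m → 1 ≤ m
  minimal y zero wy (d , _) rewrite WalkIn-0⇒≡ d = ⊥-elim (¬sv (ConnIn-last wy))
  minimal y (suc m) _ _ = s≤s z≤n
  only : ∀ C' m' → IsComponent S C' → m' ≤ 1 → DistSet v C' m' → SameSet C' (ConnIn S w)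
  only C' m' c m'≤1 d with DistSet≤1⇒near m'≤1 d
  ... | _ , cv , inj₁ refl = ⊥-elim (¬sv (proj₁ (proj₂ c) v cv))
  ... | w' , cw' , inj₂ a' =
    subst (λ x → SameSet C' (ConnIn S x)) (w-unique w' (proj₁ (proj₂ c) w' cw') a') (component≈ConnIn c cw')

-- Integer remainders

module _ (N : ℕ) .{{_ : NonZero N}} where

  private
    swap-multiple : ∀ {a b : ℤ} q → a ≡ b ℤ.+ q ℤ.* + N → b ≡ a ℤ.+ (ℤ.- q) ℤ.* + N
    swap-multiple {b = b} q refl = cancel b q (+ N)
      where
      cancel : ∀ b q N → b ≡ b ℤ.+ q ℤ.* N ℤ.+ (ℤ.- q) ℤ.* N
      cancel = solve-∀

    positive-multiple : ∀ {r s} m → + r ≡ + s ℤ.+ + suc m ℤ.* + N → N ≤ r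
    positive-multiple {r} {s} m e = ℕ.≤-trans (ℕ.m≤m+n N (m ℕ.* N)) (ℕ.≤-trans (ℕ.m≤n+m _ s)
      (ℕ.≤-reflexive (sym (ℤ.+-injective (trans e (trans (cong (ℤ._+_ (+ s)) (sym (ℤ.pos-* (suc m) N)))
        (sym (ℤ.pos-+ s _))))))))

  remainder-unique : ∀ {r s} (q : ℤ) → r < N → s < N → + r ≡ + s ℤ.+ q ℤ.* + N → r ≡ s
  remainder-unique {s = s} (+ 0) _ _ e =
    ℤ.+-injective (trans e (trans (cong (ℤ._+_ (+ s)) (ℤ.*-zeroˡ (+ N))) (ℤ.+-identityʳ (+ s))))
  remainder-unique (+ suc m) r<N _ e = ⊥-elim (ℕ.<⇒≱ r<N (positive-multiple m e))
  remainder-unique -[1+ m ] _ s<N e = ⊥-elim (ℕ.<⇒≱ s<N (positive-multiple m (swap-multiple -[1+ m ] e)))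

  %ℕ-unique : ∀ {z r} (q : ℤ) → r < N → z ≡ + r ℤ.+ q ℤ.* + N → z %ℕ N ≡ r
  %ℕ-unique {z} {r} q r<N z≡r+qN = sym (remainder-unique (z /ℕ N ℤ.- q) r<N (n%ℕd<d z N) (begin
    + r                                                   ≡⟨ swap-multiple q z≡r+qN ⟩
    z ℤ.+ (ℤ.- q) ℤ.* + N                                 ≡⟨ cong (λ t → t ℤ.+ (ℤ.- q) ℤ.* + N) (a≡a%ℕn+[a/ℕn]*n z N) ⟩
    + (z %ℕ N) ℤ.+ z /ℕ N ℤ.* + N ℤ.+ (ℤ.- q) ℤ.* + N     ≡⟨ regroup (+ (z %ℕ N)) (z /ℕ N) q (+ N) ⟩
    + (z %ℕ N) ℤ.+ (z /ℕ N ℤ.- q) ℤ.* + N                 ∎))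
    where
    open ≡-Reasoning
    regroup : ∀ r q' q N → r ℤ.+ q' ℤ.* N ℤ.+ (ℤ.- q) ℤ.* N ≡ r ℤ.+ (q' ℤ.- q) ℤ.* N
    regroup = solve-∀

  [z+m]%ℕN : ∀ z m → (z ℤ.+ + m) %ℕ N ≡ (z %ℕ N ℕ.+ m) % N
  [z+m]%ℕN z m = %ℕ-unique (+ (x / N) ℤ.+ q) (m%n<n x N) (begin
    z ℤ.+ + m                                      ≡⟨ cong (λ t → t ℤ.+ + m) (a≡a%ℕn+[a/ℕn]*n z N) ⟩
    + r ℤ.+ q ℤ.* + N ℤ.+ + m                      ≡⟨ swap (+ r) (q ℤ.* + N) (+ m) ⟩
    + r ℤ.+ + m ℤ.+ q ℤ.* + N                      ≡⟨ cong (λ t → t ℤ.+ q ℤ.* + N) (sym (ℤ.pos-+ r m)) ⟩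
    + x ℤ.+ q ℤ.* + N                              ≡⟨ cong (λ t → + t ℤ.+ q ℤ.* + N) (m≡m%n+[m/n]*n x N) ⟩
    + (x % N ℕ.+ x / N ℕ.* N) ℤ.+ q ℤ.* + N        ≡⟨ cong (λ t → t ℤ.+ q ℤ.* + N) pos-+* ⟩
    + (x % N) ℤ.+ + (x / N) ℤ.* + N ℤ.+ q ℤ.* + N  ≡⟨ regroup (+ (x % N)) (+ (x / N)) q (+ N) ⟩
    + (x % N) ℤ.+ (+ (x / N) ℤ.+ q) ℤ.* + N        ∎)
    where
    open ≡-Reasoning
    r = z %ℕ N
    q = z /ℕ N
    x = r ℕ.+ m
    pos-+* : + (x % N ℕ.+ x / N ℕ.* N) ≡ + (x % N) ℤ.+ + (x / N) ℤ.* + N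
    pos-+* = trans (ℤ.pos-+ (x % N) _) (cong (ℤ._+_ (+ (x % N))) (ℤ.pos-* (x / N) N))
    swap : ∀ a b c → a ℤ.+ b ℤ.+ c ≡ a ℤ.+ c ℤ.+ b
    swap = solve-∀
    regroup : ∀ r q' q N → r ℤ.+ q' ℤ.* N ℤ.+ q ℤ.* N ≡ r ℤ.+ (q' ℤ.+ q) ℤ.* N
    regroup = solve-∀

  [z-N]%ℕN : ∀ z → (z ℤ.- + N) %ℕ N ≡ z %ℕ N
  [z-N]%ℕN z = %ℕ-unique (z /ℕ N ℤ.- + 1) (n%ℕd<d z N)
    (trans (cong (λ t → t ℤ.- + N) (a≡a%ℕn+[a/ℕn]*n z N)) (regroup (+ (z %ℕ N)) (z /ℕ N) (+ N)))
    where
    regroup : ∀ r q N → r ℤ.+ q ℤ.* N ℤ.- N ≡ r ℤ.+ (q ℤ.- + 1) ℤ.* N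
    regroup = solve-∀

-- The residue tiling

module Tiling (n' k' : ℕ) where

  k : ℕ
  k = suc k'

  index : Fin (suc n') → Bool → ℕ
  index zero false = 0
  index (suc j) false = suc (toℕ j)
  index (suc j) true = suc (n' ℕ.+ toℕ (opposite j))
  index zero true = suc (n' ℕ.+ n')

  -- The residues from which the unit step (j, b) leads to a residue in [0, k) form the tile
  -- [start j b, start j b + k) modulo N; index enumerates the tiles from left to right.
  start : Fin (suc n') → Bool → ℕ
  start j b = suc (index j b ℕ.* k)

  N : ℕ
  N = suc (suc (suc (n' ℕ.+ n') ℕ.* k))

  index-complement : ∀ j → index j false ℕ.+ index j true ≡ suc (n' ℕ.+ n')
  index-complement zero = refl
  index-complement (suc j) = begin
    suc t ℕ.+ suc (n' ℕ.+ o)    ≡⟨ regroup t n' o ⟩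
    suc (n' ℕ.+ (suc t ℕ.+ o))  ≡⟨ cong (λ m → suc (n' ℕ.+ m)) t+o≡n' ⟩
    suc (n' ℕ.+ n')             ∎
    where
    open ≡-Reasoning
    t = toℕ j
    o = toℕ (opposite j)
    t+o≡n' : suc t ℕ.+ o ≡ n'
    t+o≡n' = trans (cong (suc t ℕ.+_) (opposite-prop j)) (ℕ.m+[n∸m]≡n (toℕ<n j))
    regroup : ∀ t n o → suc t ℕ.+ suc (n ℕ.+ o) ≡ suc (n ℕ.+ (suc t ℕ.+ o))
    regroup = ℕ-Ring.solve-∀

  start-complement : ∀ j b → start j b ℕ.+ start j (not b) ≡ N
  start-complement j false = cong suc (begin
    index j false ℕ.* k ℕ.+ suc (index j true ℕ.* k)  ≡⟨ ℕ.+-suc _ _ ⟩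
    suc (index j false ℕ.* k ℕ.+ index j true ℕ.* k)  ≡⟨ cong suc (sym (ℕ.*-distribʳ-+ k (index j false) _)) ⟩
    suc ((index j false ℕ.+ index j true) ℕ.* k)      ≡⟨ cong (λ m → suc (m ℕ.* k)) (index-complement j) ⟩
    suc (suc (n' ℕ.+ n') ℕ.* k)                       ∎)
    where open ≡-Reasoning
  start-complement j true = trans (ℕ.+-comm (start j true) _) (start-complement j false)

  private
    opposite-injective : ∀ {m} {i j : Fin m} → opposite i ≡ opposite j → i ≡ j
    opposite-injective {i = i} {j} e = trans (sym (opposite-involutive i)) (trans (cong opposite e) (opposite-involutive j))

    n'+-≢toℕ : ∀ (j : Fin n') m → toℕ j ≢ n' ℕ.+ m
    n'+-≢toℕ j m e = ℕ.<⇒≱ (toℕ<n j) (subst (n' ≤_) (sym e) (ℕ.m≤m+n n' m))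

    n'+n'≢n'+toℕ : ∀ (j : Fin n') → n' ℕ.+ n' ≢ n' ℕ.+ toℕ j
    n'+n'≢n'+toℕ j e = n'+-≢toℕ j 0 (trans (sym (ℕ.+-cancelˡ-≡ n' _ _ e)) (sym (ℕ.+-identityʳ n')))

  index-injective : ∀ {j j' b b'} → index j b ≡ index j' b' → j ≡ j' × b ≡ b'
  index-injective {zero} {zero} {false} {false} _ = refl , refl
  index-injective {zero} {zero} {true} {true} _ = refl , refl
  index-injective {suc j} {suc j'} {false} {false} e = cong suc (toℕ-injective (ℕ.suc-injective e)) , refl
  index-injective {suc j} {suc j'} {true} {true} e =
    cong suc (opposite-injective (toℕ-injective (ℕ.+-cancelˡ-≡ n' _ _ (ℕ.suc-injective e)))) , refl
  index-injective {zero} {zero} {false} {true} ()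
  index-injective {zero} {zero} {true} {false} ()
  index-injective {zero} {suc _} {false} {false} ()
  index-injective {zero} {suc _} {false} {true} ()
  index-injective {suc _} {zero} {false} {false} ()
  index-injective {suc _} {zero} {true} {false} ()
  index-injective {zero} {suc j'} {true} {false} e = ⊥-elim (n'+-≢toℕ j' n' (sym (ℕ.suc-injective e)))
  index-injective {suc j} {zero} {false} {true} e = ⊥-elim (n'+-≢toℕ j n' (ℕ.suc-injective e))
  index-injective {zero} {suc j'} {true} {true} e = ⊥-elim (n'+n'≢n'+toℕ (opposite j') (ℕ.suc-injective e))
  index-injective {suc j} {zero} {true} {true} e = ⊥-elim (n'+n'≢n'+toℕ (opposite j) (sym (ℕ.suc-injective e)))
  index-injective {suc j} {suc j'} {false} {true} e = ⊥-elim (n'+-≢toℕ j _ (ℕ.suc-injective e))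
  index-injective {suc j} {suc j'} {true} {false} e = ⊥-elim (n'+-≢toℕ j' _ (sym (ℕ.suc-injective e)))

  index-surjective : ∀ m → m ≤ suc (n' ℕ.+ n') → ∃ λ j → ∃ λ b → index j b ≡ m
  index-surjective zero _ = zero , false , refl
  index-surjective (suc m) (s≤s m≤2n') with m <? n'
  ... | yes m<n' = suc (fromℕ< m<n') , false , cong suc (toℕ-fromℕ< m<n')
  ... | no m≮n' with ℕ.m≤n⇒∃[o]m+o≡n (ℕ.≮⇒≥ m≮n')
  ...   | d , n'+d≡m with ℕ.m≤n⇒m<n∨m≡n (ℕ.+-cancelˡ-≤ n' d n' (subst (_≤ n' ℕ.+ n') (sym n'+d≡m) m≤2n'))
  ...     | inj₁ d<n' = suc (opposite (fromℕ< d<n')) , true ,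
              cong suc (trans (cong (λ i → n' ℕ.+ toℕ i) (opposite-involutive (fromℕ< d<n')))
                              (trans (cong (n' ℕ.+_) (toℕ-fromℕ< d<n')) n'+d≡m))
  ...     | inj₂ refl = zero , true , cong suc n'+d≡m

  slot : ℕ → ℕ
  slot r = ℕ.pred r / k

  slot-start : ∀ {i} j b → i < k → slot (start j b ℕ.+ i) ≡ index j b
  slot-start {i} j b i<k = begin
    (index j b ℕ.* k ℕ.+ i) / k          ≡⟨ cong (_/ k) (ℕ.+-comm _ i) ⟩
    (i ℕ.+ index j b ℕ.* k) / k          ≡⟨ +-distrib-/-∣ʳ i (divides-refl (index j b)) ⟩
    i / k ℕ.+ index j b ℕ.* k / k        ≡⟨ cong₂ ℕ._+_ (m<n⇒m/n≡0 i<k) (m*n/n≡m (index j b) k) ⟩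
    index j b                            ∎
    where open ≡-Reasoning

  tile-unique : ∀ {r i i' j j' b b'} → i < k → i' < k →
    r ≡ start j b ℕ.+ i → r ≡ start j' b' ℕ.+ i' → j ≡ j' × b ≡ b'
  tile-unique {j = j} {j'} {b} {b'} i<k i'<k refl e = index-injective (begin
    index j b                  ≡⟨ slot-start j b i<k ⟨
    slot (start j b ℕ.+ _)     ≡⟨ cong slot e ⟩
    slot (start j' b' ℕ.+ _)   ≡⟨ slot-start j' b' i'<k ⟩
    index j' b'                ∎)
    where open ≡-Reasoning

  tile-exists : ∀ {r} → k ≤ r → r < N → ∃ λ j → ∃ λ b → ∃ λ i → i < k × r ≡ start j b ℕ.+ i
  tile-exists {suc p} _ (s≤s p<N-1) with index-surjective (p / k) (ℕ.≤-pred (m<n*o⇒m/o<n p<[2n'+2]k))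
    where
    p<[2n'+2]k : p < suc (suc (n' ℕ.+ n')) ℕ.* k
    p<[2n'+2]k = ℕ.<-≤-trans p<N-1 (ℕ.+-monoˡ-≤ _ (s≤s z≤n))
  ... | j , b , index≡p/k = j , b , p % k , m%n<n p k , cong suc (begin
    p                            ≡⟨ m≡m%n+[m/n]*n p k ⟩
    p % k ℕ.+ p / k ℕ.* k        ≡⟨ ℕ.+-comm (p % k) _ ⟩
    p / k ℕ.* k ℕ.+ p % k        ≡⟨ cong (λ m → m ℕ.* k ℕ.+ p % k) index≡p/k ⟨
    index j b ℕ.* k ℕ.+ p % k    ∎)
    where open ≡-Reasoning

  -- The residue after the step (j, b): start j (not b) ≡ sgn b * start j false modulo N.
  residue : Fin (suc n') → Bool → ℕ → ℕ
  residue j b r = (r ℕ.+ start j (not b)) % N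

  Hits : Fin (suc n') → Bool → ℕ → Set
  Hits j b r = residue j b r < k

  k<N : k < N
  k<N = s≤s (ℕ.m≤n⇒m≤1+n (ℕ.m≤m+n k _))

  private
    %-below-2N : ∀ {x} → x < N ℕ.+ N → x % N ≡ x ⊎ x ≡ x % N ℕ.+ N
    %-below-2N {x} x<2N with x <? N
    ... | yes x<N = inj₁ (m<n⇒m%n≡m x<N)
    ... | no x≮N with ℕ.m≤n⇒∃[o]m+o≡n (ℕ.≮⇒≥ x≮N)
    ...   | d , refl = inj₂ (trans (ℕ.+-comm N d) (cong (ℕ._+ N) (sym [N+d]%N≡d)))
      where
      [N+d]%N≡d : (N ℕ.+ d) % N ≡ d
      [N+d]%N≡d = trans (cong (_% N) (ℕ.+-comm N d))
        (trans ([m+n]%n≡m%n d N) (m<n⇒m%n≡m (ℕ.+-cancelˡ-< N d N x<2N)))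

  residue-cases : ∀ {r} j b → r < N → residue j b r ≡ r ℕ.+ start j (not b) ⊎ r ≡ start j b ℕ.+ residue j b r
  residue-cases {r} j b r<N with %-below-2N (ℕ.+-mono-<-≤ r<N shift≤N)
    where
    shift≤N : start j (not b) ≤ N
    shift≤N = subst (start j (not b) ≤_) (start-complement j b) (ℕ.m≤n+m _ (start j b))
  ... | inj₁ no-wrap = inj₁ no-wrap
  ... | inj₂ wrap = inj₂ (trans (ℕ.+-cancelʳ-≡ (start j (not b)) r _ (begin
    r ℕ.+ start j (not b)                                 ≡⟨ wrap ⟩
    residue j b r ℕ.+ N                                   ≡⟨ cong (residue j b r ℕ.+_) (start-complement j b) ⟨
    residue j b r ℕ.+ (start j b ℕ.+ start j (not b))     ≡⟨ ℕ.+-assoc (residue j b r) _ _ ⟨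
    residue j b r ℕ.+ start j b ℕ.+ start j (not b)       ∎)) (ℕ.+-comm _ (start j b)))
    where open ≡-Reasoning

  residue-start : ∀ {i} j b → i < k → residue j b (start j b ℕ.+ i) ≡ i
  residue-start {i} j b i<k = begin
    (start j b ℕ.+ i ℕ.+ start j (not b)) % N     ≡⟨ cong (_% N) (regroup (start j b) i _) ⟩
    (i ℕ.+ (start j b ℕ.+ start j (not b))) % N   ≡⟨ cong (λ m → (i ℕ.+ m) % N) (start-complement j b) ⟩
    (i ℕ.+ N) % N                                 ≡⟨ [m+n]%n≡m%n i N ⟩
    i % N                                         ≡⟨ m<n⇒m%n≡m (ℕ.<-trans i<k k<N) ⟩
    i                                             ∎
    where
    open ≡-Reasoning
    regroup : ∀ s i s' → s ℕ.+ i ℕ.+ s' ≡ i ℕ.+ (s ℕ.+ s')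
    regroup = ℕ-Ring.solve-∀

  hits-outside : ∀ {r} j b → k ≤ r → r < N → Hits j b r → r ≡ start j b ℕ.+ residue j b r
  hits-outside {r} j b k≤r r<N hits with residue-cases j b r<N
  ... | inj₁ no-wrap =
    ⊥-elim (ℕ.<⇒≱ hits (ℕ.≤-trans k≤r (subst (r ≤_) (sym no-wrap) (ℕ.m≤m+n r (start j (not b))))))
  ... | inj₂ wrap = wrap

  start<k⇒zero-false : ∀ j b → start j b < k → j ≡ zero × b ≡ false
  start<k⇒zero-false zero false _ = refl , refl
  start<k⇒zero-false zero true lt = ⊥-elim (ℕ.<-asym lt (s≤s (ℕ.m≤m+n k _)))
  start<k⇒zero-false (suc _) false lt = ⊥-elim (ℕ.<-asym lt (s≤s (ℕ.m≤m+n k _)))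
  start<k⇒zero-false (suc _) true lt = ⊥-elim (ℕ.<-asym lt (s≤s (ℕ.m≤m+n k _)))

  hits-inside : ∀ {r} j b → r < k → Hits j b r → j ≡ zero × + residue j b r ≡ + r ℤ.+ sgn b
  hits-inside {r} j b r<k hits with residue-cases j b (ℕ.<-trans r<k k<N)
  hits-inside {r} j true r<k hits | inj₁ no-wrap
    with start<k⇒zero-false j false (ℕ.≤-<-trans (ℕ.m≤n+m _ r) (subst (_< k) no-wrap hits))
  ... | refl , _ = refl , trans (cong +_ no-wrap) (ℤ.pos-+ r 1)
  hits-inside {r} j false r<k hits | inj₁ no-wrap
    with start<k⇒zero-false j true (ℕ.≤-<-trans (ℕ.m≤n+m _ r) (subst (_< k) no-wrap hits))
  ... | _ , ()
  hits-inside {r} j b r<k hits | inj₂ wrap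
    with start<k⇒zero-false j b (ℕ.≤-<-trans (ℕ.m≤m+n _ _) (subst (_< k) wrap r<k))
  ... | refl , refl = refl , sym (cong (λ t → + t ℤ.+ -[1+ 0 ]) wrap)

-- The construction

weightedSum : ∀ {n} → (Fin n → ℕ) → Vertex n → ℤ
weightedSum w [] = + 0
weightedSum w (x ∷ v) = + w zero ℤ.* x ℤ.+ weightedSum (λ i → w (suc i)) v

weightedSum-move : ∀ {n} w (v : Vertex n) j b → weightedSum w (move v j b) ≡ weightedSum w v ℤ.+ sgn b ℤ.* + w j
weightedSum-move w (x ∷ v) zero b = distrib (+ w zero) x (sgn b) (weightedSum (λ i → w (suc i)) v)
  where
  distrib : ∀ c x d p → c ℤ.* (x ℤ.+ d) ℤ.+ p ≡ c ℤ.* x ℤ.+ p ℤ.+ d ℤ.* c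
  distrib = solve-∀
weightedSum-move w (x ∷ v) (suc j) b =
  trans (cong (ℤ._+_ (+ w zero ℤ.* x)) (weightedSum-move (λ i → w (suc i)) v j b)) (sym (ℤ.+-assoc (+ w zero ℤ.* x) _ _))

module Construction (n' k' : ℕ) where

  open Tiling n' k'

  V : Set
  V = Vertex (suc n')

  weight : Fin (suc n') → ℕ
  weight j = start j false

  ρ : V → ℕ
  ρ v = weightedSum weight v %ℕ N

  ρ<N : ∀ v → ρ v < N
  ρ<N v = n%ℕd<d (weightedSum weight v) N

  ρ-move : ∀ v j b → ρ (move v j b) ≡ residue j b (ρ v)
  ρ-move v j true = trans
    (cong (_%ℕ N) (trans (weightedSum-move _ v j true) (cong (ℤ._+_ φ) (ℤ.*-identityˡ _))))
    ([z+m]%ℕN N φ (start j false))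
    where φ = weightedSum weight v
  ρ-move v j false = trans (cong (_%ℕ N) (weightedSum-move _ v j false)) (begin
    (φ ℤ.+ sgn false ℤ.* + start j false) %ℕ N                     ≡⟨ cong (_%ℕ N) wrap ⟩
    ((φ ℤ.- + N) ℤ.+ + start j true) %ℕ N                          ≡⟨ [z+m]%ℕN N (φ ℤ.- + N) _ ⟩
    ((φ ℤ.- + N) %ℕ N ℕ.+ start j true) % N                        ≡⟨ cong (λ r → (r ℕ.+ start j true) % N) ([z-N]%ℕN N φ) ⟩
    (ρ v ℕ.+ start j true) % N                                     ∎)
    where
    open ≡-Reasoning
    φ = weightedSum weight v
    regroup : ∀ φ w s → φ ℤ.+ -[1+ 0 ] ℤ.* w ≡ (φ ℤ.- (w ℤ.+ s)) ℤ.+ s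
    regroup = solve-∀
    wrap : φ ℤ.+ sgn false ℤ.* + start j false ≡ (φ ℤ.- + N) ℤ.+ + start j true
    wrap = trans (regroup φ (+ start j false) (+ start j true))
      (cong (λ t → (φ ℤ.- t) ℤ.+ + start j true) (trans (sym (ℤ.pos-+ (start j false) _)) (cong +_ (start-complement j false))))

  S : V → Set
  S v = ρ v < k

  S-move⇒Hits : ∀ v j b → S (move v j b) → Hits j b (ρ v)
  S-move⇒Hits v j b = subst (_< k) (ρ-move v j b)

  unique-neighbour : ∀ v → ¬ S v → UniqueNeighbourIn S v
  unique-neighbour v ¬sv with tile-exists (ℕ.≮⇒≥ ¬sv) (ρ<N v)
  ... | j , b , i , i<k , ρv≡start+i = move v j b , in-S , Adj-move v j b , unique
    where
    in-S : S (move v j b)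
    in-S = subst (_< k) (sym (trans (ρ-move v j b) (trans (cong (residue j b) ρv≡start+i) (residue-start j b i<k)))) i<k
    unique : ∀ w → S w → Adj v w → w ≡ move v j b
    unique w sw a with Adj⇒move {u = v} {w} a
    ... | j' , b' , refl with S-move⇒Hits v j' b' sw
    ... | hits with tile-unique {j = j} {j'} {b} {b'} i<k hits ρv≡start+i (hits-outside j' b' (ℕ.≮⇒≥ ¬sv) (ρ<N v) hits)
    ... | refl , refl = refl

  base : V → V
  base (h ∷ u) = (h ℤ.- + ρ (h ∷ u)) ∷ u

  along : V → ℕ → V
  along (c ∷ u) l = (c ℤ.+ + l) ∷ u

  ρ-along-base : ∀ x {l} → l < N → ρ (along (base x) l) ≡ l
  ρ-along-base (h ∷ u) {l} l<N = %ℕ-unique N (φ /ℕ N) l<N (begin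
    + 1 ℤ.* (h ℤ.- + ρ (h ∷ u) ℤ.+ + l) ℤ.+ p   ≡⟨ regroup h (+ ρ (h ∷ u)) (+ l) p ⟩
    φ ℤ.- + ρ (h ∷ u) ℤ.+ + l                   ≡⟨ cong (λ t → t ℤ.- + ρ (h ∷ u) ℤ.+ + l) (a≡a%ℕn+[a/ℕn]*n φ N) ⟩
    + ρ (h ∷ u) ℤ.+ φ /ℕ N ℤ.* + N ℤ.- + ρ (h ∷ u) ℤ.+ + l  ≡⟨ cancel (+ ρ (h ∷ u)) (φ /ℕ N ℤ.* + N) (+ l) ⟩
    + l ℤ.+ φ /ℕ N ℤ.* + N                      ∎)
    where
    open ≡-Reasoning
    p = weightedSum (λ j → weight (suc j)) u
    φ = + 1 ℤ.* h ℤ.+ p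
    regroup : ∀ h r l p → + 1 ℤ.* (h ℤ.- r ℤ.+ l) ℤ.+ p ≡ + 1 ℤ.* h ℤ.+ p ℤ.- r ℤ.+ l
    regroup = solve-∀
    cancel : ∀ r q l → r ℤ.+ q ℤ.- r ℤ.+ l ≡ l ℤ.+ q
    cancel = solve-∀

  along-base : ∀ x → along (base x) (ρ x) ≡ x
  along-base (h ∷ u) = cong (_∷ u) (cancel h (+ ρ (h ∷ u)))
    where
    cancel : ∀ h r → h ℤ.- r ℤ.+ r ≡ h
    cancel = solve-∀

  along-suc : ∀ c l → along c (suc l) ≡ move (along c l) zero true
  along-suc (c ∷ u) l = cong (_∷ u) (regroup c (+ l))
    where
    regroup : ∀ c l → c ℤ.+ (+ 1 ℤ.+ l) ≡ c ℤ.+ l ℤ.+ + 1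
    regroup = solve-∀

  along-injective : ∀ c {l l'} → along c l ≡ along c l' → l ≡ l'
  along-injective (c ∷ u) e = ℤ.+-injective (ℤ-+-cancelˡ c _ _ (∷-injectiveˡ e))

  S-along-base : ∀ x {l} → l < k → S (along (base x) l)
  S-along-base x l<k = subst (_< k) (sym (ρ-along-base x (ℕ.<-trans l<k k<N))) l<k

  base-move : ∀ x j b → S x → S (move x j b) → base (move x j b) ≡ base x
  base-move (h ∷ u) j b sx sy with hits-inside j b sx (S-move⇒Hits (h ∷ u) j b sy)
  ... | refl , ρ-step = cong (_∷ u) (begin
    h ℤ.+ sgn b ℤ.- + ρ ((h ℤ.+ sgn b) ∷ u)  ≡⟨ cong (λ t → h ℤ.+ sgn b ℤ.- t) (trans (cong +_ (ρ-move (h ∷ u) zero b)) ρ-step) ⟩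
    h ℤ.+ sgn b ℤ.- (+ ρ (h ∷ u) ℤ.+ sgn b)  ≡⟨ cancel h (+ ρ (h ∷ u)) (sgn b) ⟩
    h ℤ.- + ρ (h ∷ u)                         ∎)
    where
    open ≡-Reasoning
    cancel : ∀ h r s → h ℤ.+ s ℤ.- (r ℤ.+ s) ≡ h ℤ.- r
    cancel = solve-∀

  WalkIn⇒base : ∀ {x y m} → WalkIn S x y m → base y ≡ base x
  WalkIn⇒base (here _) = refl
  WalkIn⇒base (step {x} {x'} sx a w) with Adj⇒move {u = x} {x'} a
  ... | j , b , refl = trans (WalkIn⇒base w) (base-move x j b sx (WalkIn-head w))

  Adj-along-suc : ∀ c l → Adj (along c l) (along c (suc l))
  Adj-along-suc c l = subst (Adj (along c l)) (sym (along-suc c l)) (Adj-move (along c l) zero true)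

  walk-along-base : ∀ x {l} → l < k → WalkIn S (along (base x) 0) (along (base x) l) l
  walk-along-base x {zero} l<k = here (S-along-base x l<k)
  walk-along-base x {suc l} l<k =
    WalkIn-snoc (walk-along-base x (ℕ.<-trans (ℕ.n<1+n l) l<k)) (Adj-along-suc (base x) l) (S-along-base x l<k)

  ConnIn-along-base : ∀ {x l} → S x → l < k → ConnIn S x (along (base x) l)
  ConnIn-along-base {x} sx l<k = ConnIn-trans
    (ConnIn-sym (subst (ConnIn S (along (base x) 0)) (along-base x) (_ , walk-along-base x sx)))
    (_ , walk-along-base x l<k)

  Adj-along : ∀ c l l' → Adj (along c l) (along c l') ⇔ (l ℕ.+ 1 ≡ l' ⊎ l' ℕ.+ 1 ≡ l)
  Adj-along c l l' = mk⇔ (to c) from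
    where
    unit-step : ∀ b → + l' ≡ + l ℤ.+ sgn b → l ℕ.+ 1 ≡ l' ⊎ l' ℕ.+ 1 ≡ l
    unit-step true e = inj₁ (sym (ℤ.+-injective e))
    unit-step false e = inj₂ (ℤ.+-injective (trans (ℤ.pos-+ l' 1) (trans (cong (λ t → t ℤ.+ + 1) e) (cancel (+ l)))))
      where
      cancel : ∀ b → b ℤ.+ -[1+ 0 ] ℤ.+ + 1 ≡ b
      cancel = solve-∀
    to : ∀ c → Adj (along c l) (along c l') → l ℕ.+ 1 ≡ l' ⊎ l' ℕ.+ 1 ≡ l
    to (c ∷ u) a with Adj⇒move {u = along (c ∷ u) l} {along (c ∷ u) l'} a
    ... | suc j , b , e = ⊥-elim (Adj-irrefl {v = u} (subst (Adj u) (sym (∷-injectiveʳ e)) (Adj-move u j b)))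
    ... | zero , b , e = unit-step b (ℤ-+-cancelˡ c _ _ (trans (∷-injectiveˡ e) (ℤ.+-assoc c (+ l) (sgn b))))
    from : l ℕ.+ 1 ≡ l' ⊎ l' ℕ.+ 1 ≡ l → Adj (along c l) (along c l')
    from (inj₁ refl) = subst (λ m → Adj (along c l) (along c m)) (ℕ.+-comm 1 l) (Adj-along-suc c l)
    from (inj₂ refl) = Adj-sym {u = along c l'} (subst (λ m → Adj (along c l') (along c m)) (ℕ.+-comm 1 l') (Adj-along-suc c l'))

  ConnIn-isoPath : ∀ {x} → S x → IsoPath (ConnIn S x) k
  ConnIn-isoPath {x} sx = f , (λ i → ConnIn-along-base sx (toℕ<n i)) , cover , injective ,
    λ i j → Adj-along (base x) (toℕ i) (toℕ j)
    where
    f : Fin k → V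
    f i = along (base x) (toℕ i)
    cover : ∀ y → ConnIn S x y → ∃ λ i → f i ≡ y
    cover y (_ , w) = fromℕ< sy , (begin
      along (base x) (toℕ (fromℕ< sy))  ≡⟨ cong (along (base x)) (toℕ-fromℕ< sy) ⟩
      along (base x) (ρ y)              ≡⟨ cong (λ c → along c (ρ y)) (WalkIn⇒base w) ⟨
      along (base y) (ρ y)              ≡⟨ along-base y ⟩
      y                                 ∎)
      where
      open ≡-Reasoning
      sy : S y
      sy = WalkIn-last w
    injective : ∀ i j → f i ≡ f j → i ≡ j
    injective i j e = toℕ-injective (along-injective (base x) e)

  IsComponent⇒IsoPath : ∀ C → IsComponent S C → IsoPath C k
  IsComponent⇒IsoPath C c@((x , cx) , C⊆S , _) = IsoPath-resp (component≈ConnIn c cx) (ConnIn-isoPath (C⊆S x cx))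

  isPDDS-Pk : IsPDDS-Pk 1 k S
  isPDDS-Pk = unique-neighbours⇒PDDS (λ v → ρ v <? k) unique-neighbour , IsComponent⇒IsoPath

theorem7 : (n k : ℕ) → 2 ≤ n → 1 ≤ k →
    Σ (Vertex n → Set) λ S → IsPDDS-Pk 1 k S
theorem7 (suc n') (suc k') _ _ = Construction.S n' k' , Construction.isPDDS-Pk n' k'
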